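{- Let $\prec$ be a transitive relation on $\mathbb{N}$, and let $\mathcal{B}$, $\prec_V$, $\prec_U$ be as in the context. If $I \subseteq \mathcal{B}$ is an ideal with respect to $\prec_V$ and $r \in I$, then there exists $s \in I$ with $r \prec_V s$ and $dom(r) \prec_U dom(s)$.
   Context: For a transitive relation $R$ on a countable set $S$, a subset $I \subseteq S$ is an ideal (with respect to $R$) if (1) $I \neq \emptyset$; (2) for all $a \in I$ and $b \in S$, $b R a$ implies $b \in I$; (3) for all $a,b\in I$ there is $c \in I$ with $a R c$ and $b R c$. Let $\prec$ be a transitive relation on $\mathbb{N}$. Let $\mathcal{B}$ be the set of all partial functions $r :\subseteq \mathbb{N} \to \mathbb{Q}_{>0}$ with finite domain $dom(r)$, where $\mathbb{Q}_{>0}$ is the set of rationals strictly greater than $0$. Define $\prec_V$ on $\mathcal{B}$ by: $r \prec_V s$ iff $\sum_{b\in F} r(b) < \sum_{c \in {\uparrow}F \cap dom(s)} s(c)$ for every non-empty $F \subseteq dom(r)$, where ${\uparrow}F = \{c \in \mathbb{N} \mid \exists b \in F,\ b \prec c\}$. For finite subsets $F, G \subseteq \mathbb{N}$, define $F \prec_U G$ iff for every $n \in G$ there is $m \in F$ with $m \prec n$. -}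

module Defs where

open import Data.Nat using (ℕ)
open import Data.Rational using (ℚ; 0ℚ; _+_; _<_; Positive)
open import Data.Product using (Σ; _×_; _,_; proj₁; proj₂; ∃; ∃-syntax)
open import Data.List using (List; []; _∷_; map; foldr)
open import Data.List.Relation.Unary.All using (All)
open import Data.List.Relation.Unary.Unique.Propositional using (Unique)
open import Data.List.Relation.Binary.Sublist.Propositional using (_⊆_)
open import Data.List.Membership.Propositional using (_∈_)
open import Relation.Binary.PropositionalEquality using (_≢_)
open import Function.Bundles using (_⇔_)

-- Elements of 𝓑: finite partial functions ℕ ⇀ ℚ_{>0}, represented by a
-- finite list of (argument , value) pairs with pairwise distinct arguments
-- and strictly positive values.
record 𝓑 : Set where
  constructor mk𝓑
  field
    entries : List (ℕ × ℚ)
    uniq    : Unique (map proj₁ entries)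
    pos     : All (λ e → Positive (proj₂ e)) entries
open 𝓑 public

dom : 𝓑 → List ℕ
dom r = map proj₁ (entries r)

Σval : List (ℕ × ℚ) → ℚ
Σval = foldr (λ e acc → proj₂ e + acc) 0ℚ

module _ (_≺_ : ℕ → ℕ → Set) where

  _∈↑_ : ℕ → List ℕ → Set
  c ∈↑ F = ∃[ b ] (b ∈ F × b ≺ c)

  _≺V_ : 𝓑 → 𝓑 → Set
  r ≺V s = (F : List (ℕ × ℚ)) → F ⊆ entries r → F ≢ [] →
    ∃[ G ] (G ⊆ entries s
           × (∀ c → (c ∈ map proj₁ G) ⇔ ((c ∈ dom s) × (c ∈↑ map proj₁ F)))
           × Σval F < Σval G)

  _≺U_ : List ℕ → List ℕ → Set
  F ≺U G = ∀ n → n ∈ G → ∃[ m ] (m ∈ F × m ≺ n)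

record IsIdeal {S : Set} (R : S → S → Set) (I : S → Set) : Set where
  field
    nonempty : ∃[ a ] I a
    downward : ∀ {a b} → I a → R b a → I b
    directed : ∀ {a b} → I a → I b → ∃[ c ] (I c × R a c × R b c)

-- Use directedness of I to get c ∈ I with r ≺_V c, and apply r ≺_V c to
-- F = dom r: the restriction s of c to ↑(dom r) carries all the mass that
-- ≺_V demands for every F ⊆ dom r, since ↑F ⊆ ↑(dom r). So r ≺_V s, and
-- dom r ≺_U dom s because every point of dom s lies in ↑(dom r). Finally an
-- ideal for ≺_V is closed under restriction: a second application of
-- directedness gives t ∈ I with c ≺_V t, hence s ≺_V t.
module Submission where

open import Defs
open import Data.Nat using (ℕ)
open import Data.Rational using (ℚ)
open import Data.Product using (_×_; ∃-syntax; _,_; proj₁; proj₂)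
open import Data.List using (List; []; _∷_; map)
open import Data.List.Relation.Unary.All as All using (All; [])
open import Data.List.Relation.Unary.Any using (here; there)
open import Data.List.Relation.Unary.AllPairs using (AllPairs; []; _∷_)
open import Data.List.Relation.Unary.Unique.Propositional using (Unique)
open import Data.List.Relation.Binary.Sublist.Propositional
  using (_⊆_; _⊇_; []; _∷_; _∷ʳ_; ⊆-refl; ⊆-trans; minimum)
open import Data.List.Relation.Binary.Sublist.Propositional.Properties
  using (map⁺; All-resp-⊆; Any-resp-⊆)
open import Data.List.Membership.Propositional using (_∈_)
open import Data.List.Membership.Propositional.Properties using (∈-map⁺)
open import Relation.Binary.Core using (Rel)
open import Relation.Binary.Definitions using (Transitive; _Respects_)
open import Relation.Binary.PropositionalEquality using (_≢_; refl; sym)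
open import Function.Bundles using (_⇔_; mk⇔; Equivalence)
open import Data.Empty using (⊥-elim)

module _ {a ℓ} {A : Set a} {R : Rel A ℓ} where

  AllPairs-resp-⊇ : (AllPairs R) Respects _⊇_
  AllPairs-resp-⊇ []          []         = []
  AllPairs-resp-⊇ (_    ∷ʳ p) (_  ∷ rs)  = AllPairs-resp-⊇ p rs
  AllPairs-resp-⊇ (refl ∷  p) (r∼ ∷ rs)  = All-resp-⊆ p r∼ ∷ AllPairs-resp-⊇ p rs

module _ {A K : Set} (key : A → K) where

  ∈-map-tail : ∀ {z x} {xs ys zs : List A} → All (key z ≢_) (map key zs) →
               xs ⊆ zs → x ∈ xs → key x ∈ map key (z ∷ ys) → key x ∈ map key ys
  ∈-map-tail z∉ xs⊆zs x∈xs (here kx≡kz) =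
    ⊥-elim (All.lookup z∉ (∈-map⁺ key (Any-resp-⊆ xs⊆zs x∈xs)) (sym kx≡kz))
  ∈-map-tail _  _     _    (there kx∈ys) = kx∈ys

  -- Among sublists of a list with distinct keys, an element is determined by
  -- its key, so inclusion of keys already gives the sublist relation.
  ⊆-by-keys : ∀ {xs ys zs : List A} → Unique (map key zs) → xs ⊆ zs → ys ⊆ zs →
              (∀ {x} → x ∈ xs → key x ∈ map key ys) → xs ⊆ ys
  ⊆-by-keys u [] [] keys = []
  ⊆-by-keys (_ ∷ u) (_ ∷ʳ p) (_ ∷ʳ q) keys = ⊆-by-keys u p q keys
  ⊆-by-keys (z∉ ∷ u) (z ∷ʳ p) (refl ∷ q) keys =
    z ∷ʳ ⊆-by-keys u p q (λ x∈ → ∈-map-tail z∉ p x∈ (keys x∈))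
  ⊆-by-keys (z∉ ∷ u) (refl ∷ p) (_ ∷ʳ q) keys =
    ⊥-elim (All.lookup z∉ (Any-resp-⊆ (map⁺ key q) (keys (here refl))) refl)
  ⊆-by-keys (z∉ ∷ u) (refl ∷ p) (refl ∷ q) keys =
    refl ∷ ⊆-by-keys u p q (λ x∈ → ∈-map-tail z∉ p x∈ (keys (there x∈)))

restrict : (c : 𝓑) {G : List (ℕ × ℚ)} → G ⊆ entries c → 𝓑
restrict c {G} G⊆c =
  mk𝓑 G (AllPairs-resp-⊇ (map⁺ proj₁ G⊆c) (uniq c)) (All-resp-⊆ G⊆c (pos c))

module _ (_≺_ : ℕ → ℕ → Set) where

  ∈↑-mono : ∀ {F F′ : List (ℕ × ℚ)} {c} → F ⊆ F′ →
            _∈↑_ _≺_ c (map proj₁ F) → _∈↑_ _≺_ c (map proj₁ F′)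
  ∈↑-mono F⊆F′ (b , b∈F , b≺c) = b , Any-resp-⊆ (map⁺ proj₁ F⊆F′) b∈F , b≺c

  ⊆-≺V-trans : ∀ {s c t} → entries s ⊆ entries c →
               _≺V_ _≺_ c t → _≺V_ _≺_ s t
  ⊆-≺V-trans s⊆c c≺t F F⊆s = c≺t F (⊆-trans F⊆s s⊆c)

  ≺V-restrict-↑dom : ∀ {r c} → _≺V_ _≺_ r c →
    ∃[ s ] (entries s ⊆ entries c × _≺V_ _≺_ r s × _≺U_ _≺_ (dom r) (dom s))
  ≺V-restrict-↑dom {mk𝓑 [] _ _} _ =
    mk𝓑 [] [] [] , minimum _ , (λ { [] [] F≢[] → ⊥-elim (F≢[] refl) }) , λ _ ()
  ≺V-restrict-↑dom {r@(mk𝓑 (_ ∷ _) _ _)} {c} r≺c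
    with r≺c (entries r) ⊆-refl (λ ())
  ... | G , G⊆c , G-keys , _ = restrict c G⊆c , G⊆c , r≺s , r≺Us
    where
    G↔ : ∀ k → k ∈ map proj₁ G → k ∈ dom c × _∈↑_ _≺_ k (dom r)
    G↔ k = Equivalence.to (G-keys k)

    ↔G : ∀ k → k ∈ dom c × _∈↑_ _≺_ k (dom r) → k ∈ map proj₁ G
    ↔G k = Equivalence.from (G-keys k)

    r≺Us : _≺U_ _≺_ (dom r) (map proj₁ G)
    r≺Us k k∈G = proj₂ (G↔ k k∈G)

    r≺s : _≺V_ _≺_ r (restrict c G⊆c)
    r≺s F F⊆r F≢[] with r≺c F F⊆r F≢[]
    ... | H , H⊆c , H-keys , ΣF<ΣH = H , H⊆G , H-keys′ , ΣF<ΣH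
      where
      H↔ : ∀ k → k ∈ map proj₁ H → k ∈ dom c × _∈↑_ _≺_ k (map proj₁ F)
      H↔ k = Equivalence.to (H-keys k)

      into-G : ∀ k → k ∈ dom c × _∈↑_ _≺_ k (map proj₁ F) → k ∈ map proj₁ G
      into-G k (k∈c , k∈↑F) = ↔G k (k∈c , ∈↑-mono F⊆r k∈↑F)

      H⊆G : H ⊆ G
      H⊆G = ⊆-by-keys proj₁ (uniq c) H⊆c G⊆c
              (λ {x} x∈H → into-G (proj₁ x) (H↔ (proj₁ x) (∈-map⁺ proj₁ x∈H)))

      H-keys′ : ∀ k → (k ∈ map proj₁ H) ⇔ (k ∈ map proj₁ G × _∈↑_ _≺_ k (map proj₁ F))
      H-keys′ k = mk⇔
        (λ k∈H → into-G k (H↔ k k∈H) , proj₂ (H↔ k k∈H))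
        (λ (k∈G , k∈↑F) →
          Equivalence.from (H-keys k) (Any-resp-⊆ (map⁺ proj₁ G⊆c) k∈G , k∈↑F))

  module _ {I : 𝓑 → Set} (ideal : IsIdeal (_≺V_ _≺_) I) where
    open IsIdeal ideal

    IsIdeal-⊆-closed : ∀ {c s} → I c → entries s ⊆ entries c → I s
    IsIdeal-⊆-closed {c} {s} Ic s⊆c =
      let t , It , c≺t , _ = directed Ic Ic
      in downward It (⊆-≺V-trans {s} {c} {t} s⊆c c≺t)

lemma8 : (_≺_ : ℕ → ℕ → Set) → Transitive _≺_ →
    (I : 𝓑 → Set) → IsIdeal (_≺V_ _≺_) I →
    (r : 𝓑) → I r →
    ∃[ s ] (I s × _≺V_ _≺_ r s × _≺U_ _≺_ (dom r) (dom s))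
lemma8 _≺_ _ I ideal r Ir =
  let c , Ic , r≺c , _ = IsIdeal.directed ideal Ir Ir
      s , s⊆c , r≺s , r≺Us = ≺V-restrict-↑dom _≺_ {r} {c} r≺c
  in s , IsIdeal-⊆-closed _≺_ ideal {c} {s} Ic s⊆c , r≺s , r≺Us
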